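{- Let $D$ be a finite unicyclic digraph whose (unique) directed cycle has length $2\ell\ge 4$, and suppose $D$ has bipartition $U\cup V$. If $q\ge 3$ is an odd integer and $|V(D)|\ge (q+3)/2$, then there exists a $q$-kernel $Q$ of $D$ with $Q\subseteq U$ and $|Q|\le\frac{2}{q+3}|V(D)|$.
   Context: A finite digraph is unicyclic if every vertex has in-degree exactly $1$ and its underlying undirected graph is connected (such a digraph contains exactly one directed cycle). A partition $U,V$ of $V(D)$ is a bipartition if every arc has exactly one endpoint in $U$ and one in $V$. A set is independent if there are no arcs between two of its vertices. $\mathrm{dist}(S,v)$ is the minimum over $u\in S$ of the length of a shortest directed path from $u$ to $v$. A $q$-kernel is an independent set $Q$ with $\mathrm{dist}(Q,v)\le q$ for all $v\in V(D)$. -}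

module Defs where

open import Data.Nat using (ℕ; zero; suc; _+_)
open import Data.Fin using (Fin; zero; suc; inject₁; fromℕ)
open import Data.Fin.Subset using (Subset; _∈_; _∉_)
open import Data.Product using (Σ; _×_; ∃)
open import Data.Sum using (_⊎_)
open import Data.Empty using (⊥)
open import Relation.Binary.PropositionalEquality using (_≡_)
open import Relation.Nullary using (¬_)
open import Function.Definitions using (Injective)

-- A finite digraph on vertex set Fin n, given by its arc relation
-- (Arc u v means there is an arc u → v).
Digraph : ℕ → Set₁
Digraph n = Fin n → Fin n → Set

module _ {n : ℕ} (A : Digraph n) where

  InDegreeOne : Set
  InDegreeOne = ∀ v → Σ (Fin n) λ u → A u v × (∀ w → A w v → w ≡ u)

  data UWalk : Fin n → Fin n → Set where
    here : ∀ {x} → UWalk x x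
    fwd  : ∀ {x y z} → A x y → UWalk y z → UWalk x z
    bwd  : ∀ {x y z} → A y x → UWalk y z → UWalk x z

  Connected : Set
  Connected = ∀ x y → UWalk x y

  Unicyclic : Set
  Unicyclic = InDegreeOne × Connected

  data DWalk : Fin n → Fin n → ℕ → Set where
    here : ∀ {x} → DWalk x x zero
    step : ∀ {x y z k} → A x y → DWalk y z k → DWalk x z (suc k)

  DirectedCycle : ℕ → Set
  DirectedCycle zero = ⊥
  DirectedCycle (suc k) =
    Σ (Fin (suc k) → Fin n) λ c →
      Injective _≡_ _≡_ c
      × (∀ (i : Fin k) → A (c (inject₁ i)) (c (suc i)))
      × A (c (fromℕ k)) (c zero)

  -- U, V = complement of U, is a bipartition
  IsBipartition : Subset n → Set
  IsBipartition U = ∀ u v → A u v → (u ∈ U × v ∉ U) ⊎ (u ∉ U × v ∈ U)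

  Independent : Subset n → Set
  Independent Q = ∀ u v → u ∈ Q → v ∈ Q → ¬ A u v

  DistLe : Subset n → Fin n → ℕ → Set
  DistLe Q v q = Σ (Fin n) λ u → u ∈ Q × Σ ℕ λ k → k Data.Nat.≤ q × DWalk u v k

  IsQKernel : ℕ → Subset n → Set
  IsQKernel q Q = Independent Q × (∀ v → DistLe Q v q)

module Submission where

-- The unique in-arc of each vertex gives a parent map p, and D is its even cycle with
-- in-trees hanging off it; depth v is the distance from the cycle to v.  Write q = 2m + 1
-- and let jump v ∈ {2m, 2m + 1} be the largest j ≤ q with p^j v ∈ U.  While some vertex
-- is deeper than its jump, a deepest such v yields the centre u = p^(jump v) v ∈ U, which
-- is within distance q of its whole subtree; that subtree has at least jump v + 1 ≥ m + 2
-- vertices and is deleted.  Once every vertex has depth at most its jump, the cycle is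
-- walked once from a vertex of U, opening a new centre in U (at the current or the
-- previous position) whenever the next tree leaves the reach of the current centre; the
-- vertices passed between two centres pay 2m + 1 or 2m + 2 for the later one, which also
-- pays for the first centre.  The centres lie in U, hence are independent, and
-- (m + 2) |Q| ≤ |V(D)| is the required bound as (q + 3) / 2 = m + 2.

open import Defs
open import Algebra.Properties.CommutativeSemigroup using (interchange)
open import Data.Bool using (Bool; true; false; _∧_; _∨_; not; if_then_else_)
open import Data.Bool.Properties
  using (∧-assoc; ∧-conicalˡ; ∧-conicalʳ; ∧-zeroʳ; not-involutive; not-¬; ¬-not)
  renaming (_≟_ to _≟ᵇ_)
open import Data.Empty using (⊥; ⊥-elim)
open import Data.Fin using (Fin; zero; suc; toℕ; inject₁; fromℕ; lower₁)
import Data.Fin.Properties as Fin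
open import Data.Fin.Properties
  using (_≟_; any?; toℕ-injective; toℕ-fromℕ; toℕ-inject₁; toℕ-lower₁; inject₁-lower₁; toℕ<n)
open import Data.Fin.Subset using (Subset; _⊆_; ∣_∣) renaming (_∈_ to _∈ₛ_)
open import Data.List using (List; []; _∷_; length; map; filter; allFin)
open import Data.List.Extrema.Nat using (argmax; argmax-all; f[xs]≤f[argmax])
open import Data.List.Membership.Propositional using (_∈_)
open import Data.List.Membership.Propositional.Properties using (∈-filter⁺; ∈-allFin; ∈-map⁺)
open import Data.List.Properties using (length-map)
open import Data.List.Relation.Unary.All using (All; []; _∷_)
import Data.List.Relation.Unary.All as All
open import Data.List.Relation.Unary.All.Properties using (all-filter; map⁺)
open import Data.List.Relation.Unary.Any using (here; there)
import Data.List.Relation.Unary.Any as Any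
open import Data.Nat using (ℕ; zero; suc; _+_; _*_; _∸_; _≤_; _<_; z≤n; s≤s; _≤?_; _<?_; _%_; _/_)
import Data.Nat as ℕ
open import Data.Nat.DivMod using (m≡m%n+[m/n]*n)
open import Data.Nat.GeneralisedArithmetic using (fold; fold-+)
open import Data.Nat.Properties hiding (_≟_)
open import Data.Nat.Tactic.RingSolver using (solve-∀)
open import Data.Product using (Σ; _×_; _,_; proj₁; proj₂)
open import Data.Sum using (_⊎_; inj₁; inj₂; [_,_]′)
open import Data.Vec using (tabulate; lookup)
open import Data.Vec.Properties using (lookup∘tabulate; []=⇒lookup; lookup⇒[]=)
open import Function using (_∘_; id; case_of_)
open import Function.Definitions using (Injective)
open import Relation.Binary using (tri<; tri≈; tri>)
open import Relation.Binary.PropositionalEquality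
open import Relation.Nullary using (Dec; yes; no; does; ¬_)
open import Relation.Nullary.Decidable using (dec-true; dec-false; _×-dec_)
open import Relation.Unary using (Decidable)

from-does : ∀ {P : Set} (P? : Dec P) → does P? ≡ true → P
from-does (yes p) _ = p

-- Counting the elements of a Boolean predicate on Fin n

bit : Bool → ℕ
bit true  = 1
bit false = 0

count : ∀ {n} → (Fin n → Bool) → ℕ
count {zero}  P = 0
count {suc n} P = bit (P zero) + count (P ∘ suc)

count-cong : ∀ {n} {P Q : Fin n → Bool} → (∀ x → P x ≡ Q x) → count P ≡ count Q
count-cong {zero}  P≗Q = refl
count-cong {suc n} P≗Q = cong₂ _+_ (cong bit (P≗Q zero)) (count-cong (P≗Q ∘ suc))

count-all : ∀ n → count {n} (λ _ → true) ≡ n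
count-all zero    = refl
count-all (suc n) = cong suc (count-all n)

count-split : ∀ {n} (P Q : Fin n → Bool) →
              count P ≡ count (λ x → P x ∧ Q x) + count (λ x → P x ∧ not (Q x))
count-split {zero}  P Q = refl
count-split {suc n} P Q =
  trans (cong₂ _+_ (bit-split (P zero) (Q zero)) (count-split (P ∘ suc) (Q ∘ suc)))
        (interchange +-commutativeSemigroup (bit (P zero ∧ Q zero)) (bit (P zero ∧ not (Q zero))) _ _)
  where
  bit-split : ∀ a b → bit a ≡ bit (a ∧ b) + bit (a ∧ not b)
  bit-split true  true  = refl
  bit-split true  false = refl
  bit-split false _     = refl

count-mono : ∀ {n} {P Q : Fin n → Bool} → (∀ x → P x ≡ true → Q x ≡ true) → count P ≤ count Q
count-mono {zero}  P⊆Q = z≤n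
count-mono {suc n} P⊆Q = +-mono-≤ (bit-mono (P⊆Q zero)) (count-mono (P⊆Q ∘ suc))
  where
  bit-mono : ∀ {a b} → (a ≡ true → b ≡ true) → bit a ≤ bit b
  bit-mono {true}  a⇒b rewrite a⇒b refl = ≤-refl
  bit-mono {false} a⇒b = z≤n

count-∨ : ∀ {n} (P Q : Fin n → Bool) → count (λ x → P x ∨ Q x) ≤ count P + count Q
count-∨ {zero}  P Q = z≤n
count-∨ {suc n} P Q =
  ≤-trans (+-mono-≤ (bit-∨ (P zero) (Q zero)) (count-∨ (P ∘ suc) (Q ∘ suc)))
          (≤-reflexive (interchange +-commutativeSemigroup (bit (P zero)) (bit (Q zero)) _ _))
  where
  bit-∨ : ∀ a b → bit (a ∨ b) ≤ bit a + bit b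
  bit-∨ true  b = s≤s z≤n
  bit-∨ false b = ≤-refl

count-pos : ∀ {n} {P : Fin n → Bool} (x : Fin n) → P x ≡ true → 1 ≤ count P
count-pos {P = P} zero    Px rewrite Px = s≤s z≤n
count-pos {P = P} (suc x) Px = ≤-trans (count-pos {P = P ∘ suc} x Px) (m≤n+m _ (bit (P zero)))

count-none : ∀ n → count {n} (λ _ → false) ≡ 0
count-none zero    = refl
count-none (suc n) = count-none n

count-≟ : ∀ {n} (x : Fin n) → count (λ y → does (y ≟ x)) ≤ 1
count-≟ {suc n} zero    = ≤-reflexive (cong suc (count-none n))
count-≟ {suc n} (suc x) = count-≟ x

_∈ᵇ_ : ∀ {n} → Fin n → List (Fin n) → Bool
v ∈ᵇ xs = does (Any.any? (v ≟_) xs)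

count-∈ᵇ : ∀ {n} (xs : List (Fin n)) → count (_∈ᵇ xs) ≤ length xs
count-∈ᵇ {n} []       = ≤-reflexive (count-none n)
count-∈ᵇ     (x ∷ xs) =
  ≤-trans (count-∨ (λ v → does (v ≟ x)) (_∈ᵇ xs)) (+-mono-≤ (count-≟ x) (count-∈ᵇ xs))

∣tabulate∣≡count : ∀ {n} (P : Fin n → Bool) → ∣ tabulate P ∣ ≡ count P
∣tabulate∣≡count {zero}  P = refl
∣tabulate∣≡count {suc n} P with P zero
... | true  = cong suc (∣tabulate∣≡count (P ∘ suc))
... | false = ∣tabulate∣≡count (P ∘ suc)

injective⇒≤count : ∀ {m n} {P : Fin n → Bool} (g : Fin m → Fin n) → Injective _≡_ _≡_ g →
                   (∀ i → P (g i) ≡ true) → m ≤ count P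
injective⇒≤count {zero}  g g-inj Pg = z≤n
injective⇒≤count {suc m} {n} {P} g g-inj Pg = begin
  1 + m                                              ≤⟨ +-mono-≤ g₀-counted rest-counted ⟩
  count (λ x → P x ∧ is-g₀ x) + count (λ x → P x ∧ not (is-g₀ x)) ≡⟨ count-split P is-g₀ ⟨
  count P                                            ∎
  where
  open ≤-Reasoning
  is-g₀ : Fin n → Bool
  is-g₀ x = does (x ≟ g zero)
  g₀-counted : 1 ≤ count (λ x → P x ∧ is-g₀ x)
  g₀-counted = count-pos (g zero) (cong₂ _∧_ (Pg zero) (dec-true (g zero ≟ g zero) refl))
  rest-counted : m ≤ count (λ x → P x ∧ not (is-g₀ x))
  rest-counted = injective⇒≤count (g ∘ suc) (Fin.suc-injective ∘ g-inj) λ i →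
    cong₂ _∧_ (Pg (suc i)) (cong not (dec-false (g (suc i) ≟ g zero) (Fin.0≢1+n ∘ sym ∘ g-inj)))

maximum-attained : ∀ {n} (S : Fin n → Bool) (f : Fin n → ℕ) {x : Fin n} → S x ≡ true →
                   Σ (Fin n) λ v → S v ≡ true × (∀ w → S w ≡ true → f w ≤ f v)
maximum-attained {n} S f {x} Sx =
  argmax f x xs , argmax-all f Sx (all-filter S? (allFin n)) ,
  λ w Sw → All.lookup (f[xs]≤f[argmax] x xs) (∈-filter⁺ S? (∈-allFin w) Sw)
  where
  S? : ∀ w → Dec (S w ≡ true)
  S? w = S w ≟ᵇ true
  xs : List (Fin n)
  xs = filter S? (allFin n)

least : ∀ {P : ℕ → Set} → Decidable P → ∀ {k} → P k → Σ ℕ λ j → P j × (∀ i → i < j → ¬ P i)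
least P? {zero}  Pk = 0 , Pk , λ _ ()
least P? {suc k} Pk with P? 0
... | yes P0 = 0 , P0 , λ _ ()
... | no ¬P0 with least (P? ∘ suc) Pk
...   | j , Pj , below = suc j , Pj , λ { zero _ → ¬P0 ; (suc i) (s≤s i<j) → below i i<j }

least-unique : ∀ {P : ℕ → Set} {a b} → P a → (∀ i → i < a → ¬ P i) →
               P b → (∀ i → i < b → ¬ P i) → a ≡ b
least-unique Pa a-least Pb b-least with <-cmp _ _
... | tri< a<b _ _ = ⊥-elim (b-least _ a<b Pa)
... | tri≈ _ a≡b _ = a≡b
... | tri> _ _ b<a = ⊥-elim (a-least _ b<a Pb)

-- Arithmetic of the scan around the cycle

parity : ∀ t → Σ ℕ (λ a → t ≡ a + a) ⊎ Σ ℕ (λ a → t ≡ suc (a + a))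
parity zero    = inj₁ (0 , refl)
parity (suc t) with parity t
... | inj₁ (a , t≡a+a)   = inj₂ (a , cong suc t≡a+a)
... | inj₂ (a , t≡1+a+a) = inj₁ (suc a , trans (cong suc t≡1+a+a) (cong suc (sym (+-suc a a))))

even≢odd′ : ∀ a b → a + a ≢ suc (b + b)
even≢odd′ a b eq = even≢odd a b (begin
  2 * a              ≡⟨ cong (a +_) (+-identityʳ a) ⟩
  a + a              ≡⟨ eq ⟩
  suc (b + b)        ≡⟨ cong (λ x → suc (b + x)) (+-identityʳ b) ⟨
  suc (2 * b)        ∎)
  where open ≡-Reasoning

mass-grows : ∀ {t B X F T C} → suc t + B + X ≤ F + C → 1 ≤ T → suc (suc t) + B + X ≤ F + T + C
mass-grows {t} {B} {X} {F} {T} {C} mass 1≤T = begin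
  suc (suc t) + B + X   ≡⟨ shuffle t B X ⟩
  1 + (suc t + B + X)   ≤⟨ +-mono-≤ 1≤T mass ⟩
  T + (F + C)           ≡⟨ shuffle′ T F C ⟩
  F + T + C             ∎
  where
  open ≤-Reasoning
  shuffle : ∀ t B X → suc (suc t) + B + X ≡ 1 + (suc t + B + X)
  shuffle = solve-∀
  shuffle′ : ∀ T F C → T + (F + C) ≡ F + T + C
  shuffle′ = solve-∀

mass-new-centre : ∀ {t B X W F T C C′ h} → suc t + B + X ≤ F + C → suc h ≤ T → C + W ≤ h + C′ →
                  suc (suc t) + B + (W + X) ≤ F + T + C′
mass-new-centre {t} {B} {X} {W} {F} {T} {C} {C′} {h} mass path gain = begin
  suc (suc t) + B + (W + X)   ≡⟨ shuffle t B X W ⟩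
  (suc t + B + X) + suc W     ≤⟨ +-monoˡ-≤ (suc W) mass ⟩
  F + C + suc W               ≡⟨ shuffle′ F C W ⟩
  F + suc (C + W)             ≤⟨ +-monoʳ-≤ F (s≤s gain) ⟩
  F + (suc h + C′)            ≡⟨ +-assoc F (suc h) C′ ⟨
  F + suc h + C′              ≤⟨ +-monoˡ-≤ C′ (+-monoʳ-≤ F path) ⟩
  F + T + C′                  ∎
  where
  open ≤-Reasoning
  shuffle : ∀ t B X W → suc (suc t) + B + (W + X) ≡ (suc t + B + X) + suc W
  shuffle = solve-∀
  shuffle′ : ∀ F C W → F + C + suc W ≡ F + suc (C + W)
  shuffle′ = solve-∀

gain-from-violation : ∀ {C T W h} → C ≤ T → W ≤ h + (T ∸ C) → C + W ≤ h + T
gain-from-violation {C} {T} {W} {h} C≤T W≤ = begin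
  C + W              ≤⟨ +-monoʳ-≤ C W≤ ⟩
  C + (h + (T ∸ C))  ≡⟨ +-assoc C h _ ⟨
  C + h + (T ∸ C)    ≡⟨ cong (_+ (T ∸ C)) (+-comm C h) ⟩
  h + C + (T ∸ C)    ≡⟨ +-assoc h C _ ⟩
  h + (C + (T ∸ C))  ≡⟨ cong (h +_) (m+[n∸m]≡n C≤T) ⟩
  h + T              ∎
  where open ≤-Reasoning

mass-without-centre : ∀ {k C X M} → suc C ≤ k → suc k + X ≤ M + C → 2 + X ≤ M
mass-without-centre {k} {C} {X} {M} C<k mass = +-cancelʳ-≤ C _ _ (begin
  2 + X + C        ≡⟨ shuffle X C ⟩
  suc (suc C) + X  ≤⟨ +-monoˡ-≤ X (s≤s C<k) ⟩
  suc k + X        ≤⟨ mass ⟩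
  M + C            ∎)
  where
  open ≤-Reasoning
  shuffle : ∀ X C → 2 + X + C ≡ suc (suc C) + X
  shuffle = solve-∀

-- With B = 1 every centre after the first pays W = 2m + 1, with B = 0 it pays 2m + 2;
-- either way the surplus over m + 2 pays for the first centre.
centres-bound : ∀ {m B W} l → 1 ≤ m → W + B ≡ suc (suc (m + m)) → B ≡ 1 ⊎ B ≡ 0 →
                (2 + m) * (2 + l) ≤ 2 + (B + (1 + l) * W)
centres-bound {suc m′} {B} {W} l _ W+B≡ (inj₁ refl) = begin
  (3 + m′) * (2 + l)                        ≤⟨ m≤m+n _ (m′ * l) ⟩
  (3 + m′) * (2 + l) + m′ * l               ≡⟨ identity m′ l ⟩
  2 + (1 + (1 + l) * suc (suc m′ + suc m′)) ≡⟨ cong (λ w → 2 + (1 + (1 + l) * w)) W≡ ⟨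
  2 + (1 + (1 + l) * W)                     ∎
  where
  open ≤-Reasoning
  W≡ : W ≡ suc (suc m′ + suc m′)
  W≡ = suc-injective (trans (+-comm 1 W) W+B≡)
  identity : ∀ m′ l → (3 + m′) * (2 + l) + m′ * l ≡ 2 + (1 + (1 + l) * suc (suc m′ + suc m′))
  identity = solve-∀
centres-bound {m} {B} {W} l _ W+B≡ (inj₂ refl) = begin
  (2 + m) * (2 + l)                         ≤⟨ m≤m+n _ (m * l) ⟩
  (2 + m) * (2 + l) + m * l                 ≡⟨ identity m l ⟩
  2 + (0 + (1 + l) * suc (suc (m + m)))     ≡⟨ cong (λ w → 2 + (0 + (1 + l) * w)) W≡ ⟨
  2 + (0 + (1 + l) * W)                     ∎
  where
  open ≤-Reasoning
  W≡ : W ≡ suc (suc (m + m))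
  W≡ = trans (sym (+-identityʳ W)) W+B≡
  identity : ∀ m l → (2 + m) * (2 + l) + m * l ≡ 2 + (0 + (1 + l) * suc (suc (m + m)))
  identity = solve-∀

-- Ancestors and depth in a functional graph

module Ancestors {n} (p : Fin n → Fin n) where

  anc : ℕ → Fin n → Fin n
  anc j v = fold v p j

  anc-+ : ∀ a b v → anc a (anc b v) ≡ anc (a + b) v
  anc-+ a b v = sym (fold-+ v p a)

  anc-p : ∀ j v → anc j (p v) ≡ anc (suc j) v
  anc-p j v = trans (anc-+ j 1 v) (cong (λ i → anc i v) (+-comm j 1))

module Depth {n} (p : Fin n → Fin n) {C : Fin n → Set} (C? : Decidable C)
             (reaches : ∀ v → Σ ℕ λ j → C (Ancestors.anc p j v)) where

  open Ancestors p

  private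
    first : ∀ v → Σ ℕ λ j → C (anc j v) × (∀ i → i < j → ¬ C (anc i v))
    first v = least (λ j → C? (anc j v)) {proj₁ (reaches v)} (proj₂ (reaches v))

  abstract
    depth : Fin n → ℕ
    depth v = proj₁ (first v)

    depth∈C : ∀ v → C (anc (depth v) v)
    depth∈C v = proj₁ (proj₂ (first v))

    ∉C-below-depth : ∀ v {i} → i < depth v → ¬ C (anc i v)
    ∉C-below-depth v = proj₂ (proj₂ (first v)) _

  root : Fin n → Fin n
  root v = anc (depth v) v

  root∈C : ∀ v → C (root v)
  root∈C = depth∈C

  depth≡0 : ∀ {v} → C v → depth v ≡ 0
  depth≡0 {v} Cv = least-unique (root∈C v) (λ _ → ∉C-below-depth v) Cv (λ _ ())

  root-C : ∀ {v} → C v → root v ≡ v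
  root-C {v} Cv = cong (λ d → anc d v) (depth≡0 Cv)

  depth-p : ∀ {v} → ¬ C v → depth v ≡ suc (depth (p v))
  depth-p {v} ¬Cv = least-unique (root∈C v) (λ _ → ∉C-below-depth v)
    (subst C (anc-p (depth (p v)) v) (root∈C (p v)))
    λ { zero _ → ¬Cv ; (suc i) (s≤s i<d) → ∉C-below-depth (p v) i<d ∘ subst C (sym (anc-p i v)) }

  depth-anc : ∀ v j → j ≤ depth v → depth (anc j v) + j ≡ depth v
  depth-anc v zero    _   = +-identityʳ _
  depth-anc v (suc j) j<d = begin
    depth (p (anc j v)) + suc j    ≡⟨ +-suc _ j ⟩
    suc (depth (p (anc j v))) + j  ≡⟨ cong (_+ j) (depth-p {anc j v} (∉C-below-depth v j<d)) ⟨
    depth (anc j v) + j            ≡⟨ depth-anc v j (<⇒≤ j<d) ⟩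
    depth v                        ∎
    where open ≡-Reasoning

  root-anc : ∀ v j → j ≤ depth v → root (anc j v) ≡ root v
  root-anc v j j≤d = trans (anc-+ (depth (anc j v)) j v) (cong (λ i → anc i v) (depth-anc v j j≤d))

  anc-injective : ∀ v {i j} → i ≤ depth v → j ≤ depth v → anc i v ≡ anc j v → i ≡ j
  anc-injective v {i} {j} i≤d j≤d eq = +-cancelˡ-≡ (depth (anc i v)) i j (begin
    depth (anc i v) + i  ≡⟨ depth-anc v i i≤d ⟩
    depth v              ≡⟨ depth-anc v j j≤d ⟨
    depth (anc j v) + j  ≡⟨ cong (λ u → depth u + j) eq ⟨
    depth (anc i v) + j  ∎)
    where open ≡-Reasoning

-- Walking around a cycle

module Cycle {n} (p : Fin n → Fin n) {k} (c : Fin (suc k) → Fin n)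
             (p-c-suc : ∀ (i : Fin k) → p (c (suc i)) ≡ c (inject₁ i))
             (p-c-zero : p (c zero) ≡ c (fromℕ k)) where

  open Ancestors p

  OnCycle : Fin n → Set
  OnCycle v = Σ (Fin (suc k)) λ i → v ≡ c i

  onCycle? : Decidable OnCycle
  onCycle? v = any? (λ i → v ≟ c i)

  prev : Fin (suc k) → Fin (suc k)
  prev zero    = fromℕ k
  prev (suc i) = inject₁ i

  p-c : ∀ i → p (c i) ≡ c (prev i)
  p-c zero    = p-c-zero
  p-c (suc i) = p-c-suc i

  OnCycle-p : ∀ {v} → OnCycle v → OnCycle (p v)
  OnCycle-p (i , refl) = prev i , p-c i

  next : Fin (suc k) → Fin (suc k)
  next i with toℕ i ℕ.≟ k
  ... | yes _   = zero
  ... | no  i≢k = suc (lower₁ i (i≢k ∘ sym))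

  p-next : ∀ i → p (c (next i)) ≡ c i
  p-next i with toℕ i ℕ.≟ k
  ... | yes i≡k = trans p-c-zero (cong c (toℕ-injective (trans (toℕ-fromℕ k) (sym i≡k))))
  ... | no  _   = trans (p-c-suc _) (cong c (inject₁-lower₁ i _))

  next-prev : ∀ i → next (prev i) ≡ i
  next-prev zero with toℕ (fromℕ k) ℕ.≟ k
  ... | yes _   = refl
  ... | no  ≢k  = ⊥-elim (≢k (toℕ-fromℕ k))
  next-prev (suc i) with toℕ (inject₁ i) ℕ.≟ k
  ... | yes ≡k = ⊥-elim (<⇒≢ (subst (_< k) (sym (toℕ-inject₁ i)) (toℕ<n i)) ≡k)
  ... | no  _  = cong suc (toℕ-injective (trans (toℕ-lower₁ (inject₁ i) _) (toℕ-inject₁ i)))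

  toℕ-next : ∀ i → toℕ i ≢ k → toℕ (next i) ≡ suc (toℕ i)
  toℕ-next i i≢k with toℕ i ℕ.≟ k
  ... | yes i≡k = ⊥-elim (i≢k i≡k)
  ... | no  _   = cong suc (toℕ-lower₁ i _)

  next-last : ∀ i → toℕ i ≡ k → next i ≡ zero
  next-last i i≡k with toℕ i ℕ.≟ k
  ... | yes _   = refl
  ... | no  i≢k = ⊥-elim (i≢k i≡k)

  -- The cycle walked along its arcs starting at s; toℕ (pos t) is s + t reduced mod suc k.
  module Walk (s : Fin (suc k)) where

    pos : ℕ → Fin (suc k)
    pos zero    = s
    pos (suc t) = next (pos t)

    anc-pos : ∀ d t → anc d (c (pos (d + t))) ≡ c (pos t)
    anc-pos zero    t = refl
    anc-pos (suc d) t = begin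
      anc (suc d) (c (pos (suc d + t)))  ≡⟨ anc-p d _ ⟨
      anc d (p (c (next (pos (d + t)))))  ≡⟨ cong (anc d) (p-next (pos (d + t))) ⟩
      anc d (c (pos (d + t)))            ≡⟨ anc-pos d t ⟩
      c (pos t)                          ∎
      where open ≡-Reasoning

    toℕ-pos : ∀ t → toℕ s + t < suc k → toℕ (pos t) ≡ toℕ s + t
    toℕ-pos zero    _  = sym (+-identityʳ (toℕ s))
    toℕ-pos (suc t) lt = begin
      toℕ (next (pos t))  ≡⟨ toℕ-next (pos t) (λ e → <⇒≢ s+t<k (trans (sym ih) e)) ⟩
      suc (toℕ (pos t))   ≡⟨ cong suc ih ⟩
      suc (toℕ s + t)     ≡⟨ +-suc (toℕ s) t ⟨
      toℕ s + suc t       ∎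
      where
      open ≡-Reasoning
      s+t<k : toℕ s + t < k
      s+t<k = ≤-pred (subst (_≤ suc k) (cong suc (+-suc (toℕ s) t)) lt)
      ih : toℕ (pos t) ≡ toℕ s + t
      ih = toℕ-pos t (≤-trans (s≤s (+-monoʳ-≤ (toℕ s) (n≤1+n t))) lt)

    toℕ-pos-wrapped : ∀ t → t < suc k → suc k ≤ toℕ s + t → toℕ (pos t) + suc k ≡ toℕ s + t
    toℕ-pos-wrapped zero    _  le = ⊥-elim (<⇒≱ (toℕ<n s) (subst (suc k ≤_) (+-identityʳ (toℕ s)) le))
    toℕ-pos-wrapped (suc t) lt le with toℕ s + t <? suc k
    ... | yes s+t<N = begin
      toℕ (next (pos t)) + suc k  ≡⟨ cong (λ i → toℕ i + suc k) (next-last (pos t) pos≡k) ⟩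
      suc k                       ≡⟨ cong suc s+t≡k ⟨
      suc (toℕ s + t)             ≡⟨ +-suc (toℕ s) t ⟨
      toℕ s + suc t               ∎
      where
      open ≡-Reasoning
      s+t≡k : toℕ s + t ≡ k
      s+t≡k = ≤-antisym (≤-pred s+t<N) (≤-pred (subst (suc k ≤_) (+-suc (toℕ s) t) le))
      pos≡k : toℕ (pos t) ≡ k
      pos≡k = trans (toℕ-pos t s+t<N) s+t≡k
    ... | no s+t≮N = begin
      toℕ (next (pos t)) + suc k  ≡⟨ cong (_+ suc k) (toℕ-next (pos t) pos≢k) ⟩
      suc (toℕ (pos t) + suc k)   ≡⟨ cong suc ih ⟩
      suc (toℕ s + t)             ≡⟨ +-suc (toℕ s) t ⟨
      toℕ s + suc t               ∎
      where
      open ≡-Reasoning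
      ih : toℕ (pos t) + suc k ≡ toℕ s + t
      ih = toℕ-pos-wrapped t (≤-trans (n≤1+n (suc t)) lt) (≮⇒≥ s+t≮N)
      pos≢k : toℕ (pos t) ≢ k
      pos≢k e = <⇒≢ (≤-trans (+-mono-≤-< (≤-pred (toℕ<n s)) (≤-pred lt)) (+-monoʳ-≤ k (n≤1+n k)))
                    (trans (sym ih) (cong (_+ suc k) e))

    private
      unwrapped≢wrapped : ∀ t₁ t₂ → t₂ < suc k → toℕ s + t₁ < suc k → suc k ≤ toℕ s + t₂ →
                          pos t₁ ≢ pos t₂
      unwrapped≢wrapped t₁ t₂ t₂<N a₁ b₂ eq = <⇒≱ t₂<N (≤-trans (m≤n+m (suc k) t₁) (≤-reflexive
        (+-cancelˡ-≡ (toℕ s) _ _ (begin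
          toℕ s + (t₁ + suc k)    ≡⟨ +-assoc (toℕ s) t₁ (suc k) ⟨
          toℕ s + t₁ + suc k      ≡⟨ cong (_+ suc k) (toℕ-pos t₁ a₁) ⟨
          toℕ (pos t₁) + suc k    ≡⟨ cong (λ i → toℕ i + suc k) eq ⟩
          toℕ (pos t₂) + suc k    ≡⟨ toℕ-pos-wrapped t₂ t₂<N b₂ ⟩
          toℕ s + t₂              ∎))))
        where open ≡-Reasoning

    pos-injective : ∀ {t₁ t₂} → t₁ < suc k → t₂ < suc k → pos t₁ ≡ pos t₂ → t₁ ≡ t₂
    pos-injective {t₁} {t₂} t₁<N t₂<N eq with toℕ s + t₁ <? suc k | toℕ s + t₂ <? suc k
    ... | yes a₁ | yes a₂ = +-cancelˡ-≡ (toℕ s) t₁ t₂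
          (trans (sym (toℕ-pos t₁ a₁)) (trans (cong toℕ eq) (toℕ-pos t₂ a₂)))
    ... | no b₁  | no b₂  = +-cancelˡ-≡ (toℕ s) t₁ t₂
          (trans (sym (toℕ-pos-wrapped t₁ t₁<N (≮⇒≥ b₁)))
                 (trans (cong (λ i → toℕ i + suc k) eq) (toℕ-pos-wrapped t₂ t₂<N (≮⇒≥ b₂))))
    ... | yes a₁ | no b₂  = ⊥-elim (unwrapped≢wrapped t₁ t₂ t₂<N a₁ (≮⇒≥ b₂) eq)
    ... | no b₁  | yes a₂ = ⊥-elim (unwrapped≢wrapped t₂ t₁ t₁<N a₂ (≮⇒≥ b₁) (sym eq))

    pos-surjective : ∀ i → Σ ℕ λ t → t < suc k × pos t ≡ i
    pos-surjective i with toℕ s ≤? toℕ i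
    ... | yes s≤i = toℕ i ∸ toℕ s , ≤-trans (s≤s (m∸n≤m (toℕ i) (toℕ s))) (toℕ<n i) ,
                    toℕ-injective (trans (toℕ-pos _ (subst (_< suc k) (sym eq) (toℕ<n i))) eq)
      where
      eq : toℕ s + (toℕ i ∸ toℕ s) ≡ toℕ i
      eq = m+[n∸m]≡n s≤i
    ... | no s≰i = (toℕ i + suc k) ∸ toℕ s , t<N ,
                   toℕ-injective (+-cancelʳ-≡ (suc k) _ _
                     (trans (toℕ-pos-wrapped _ t<N (subst (suc k ≤_) (sym eq) (m≤n+m (suc k) (toℕ i)))) eq))
      where
      eq : toℕ s + ((toℕ i + suc k) ∸ toℕ s) ≡ toℕ i + suc k
      eq = m+[n∸m]≡n (≤-trans (<⇒≤ (toℕ<n s)) (m≤n+m (suc k) (toℕ i)))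
      t<N : (toℕ i + suc k) ∸ toℕ s < suc k
      t<N = +-cancelˡ-< (toℕ s) _ _ (subst (_< toℕ s + suc k) (sym eq) (+-monoˡ-< (suc k) (≰⇒> s≰i)))

-- The construction of the centres

module Construction
  {n} (p : Fin n → Fin n) (col : Fin n → Bool) (col-p : ∀ v → col (p v) ≡ not (col v))
  {k} (c : Fin (suc k) → Fin n) (c-injective : Injective _≡_ _≡_ c)
  (p-c-suc : ∀ (i : Fin k) → p (c (suc i)) ≡ c (inject₁ i)) (p-c-zero : p (c zero) ≡ c (fromℕ k))
  (reaches : ∀ v → Σ ℕ λ j → Cycle.OnCycle p c p-c-suc p-c-zero (Ancestors.anc p j v))
  (ℓ : ℕ) (2≤ℓ : 2 ≤ ℓ) (cycle-length : suc k ≡ ℓ + ℓ)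
  (m : ℕ) (1≤m : 1 ≤ m) where

  open Ancestors p
  open Cycle p c p-c-suc p-c-zero
  open Depth p onCycle? reaches

  3≤k : 3 ≤ k
  3≤k = ≤-pred (≤-trans (+-mono-≤ 2≤ℓ 2≤ℓ) (≤-reflexive (sym cycle-length)))

  col-anc-even : ∀ a v → col (anc (a + a) v) ≡ col v
  col-anc-even zero    v = refl
  col-anc-even (suc a) v = begin
    col (p (anc (a + suc a) v))        ≡⟨ col-p _ ⟩
    not (col (anc (a + suc a) v))      ≡⟨ cong (λ j → not (col (anc j v))) (+-suc a a) ⟩
    not (col (p (anc (a + a) v)))      ≡⟨ cong not (col-p _) ⟩
    not (not (col (anc (a + a) v)))    ≡⟨ not-involutive _ ⟩
    col (anc (a + a) v)                ≡⟨ col-anc-even a v ⟩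
    col v                              ∎
    where open ≡-Reasoning

  col-anc-odd : ∀ a v → col (anc (suc (a + a)) v) ≡ not (col v)
  col-anc-odd a v = trans (col-p _) (cong not (col-anc-even a v))

  col-next : ∀ i → col (c (next i)) ≡ not (col (c i))
  col-next i = begin
    col (c (next i))                ≡⟨ not-involutive _ ⟨
    not (not (col (c (next i))))    ≡⟨ cong not (col-p _) ⟨
    not (col (p (c (next i))))      ≡⟨ cong (not ∘ col) (p-next i) ⟩
    not (col (c i))                 ∎
    where open ≡-Reasoning

  module _ (s : Fin (suc k)) where
    open Walk s

    col-pos-even : ∀ a → col (c (pos (a + a))) ≡ col (c s)
    col-pos-even zero    = refl
    col-pos-even (suc a) = begin
      col (c (next (pos (a + suc a))))         ≡⟨ col-next _ ⟩
      not (col (c (pos (a + suc a))))          ≡⟨ cong (λ t → not (col (c (pos t)))) (+-suc a a) ⟩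
      not (col (c (next (pos (a + a)))))       ≡⟨ cong not (col-next _) ⟩
      not (not (col (c (pos (a + a)))))        ≡⟨ not-involutive _ ⟩
      col (c (pos (a + a)))                    ≡⟨ col-pos-even a ⟩
      col (c s)                                ∎
      where open ≡-Reasoning

    col-pos-odd : ∀ a → col (c (pos (suc (a + a)))) ≡ not (col (c s))
    col-pos-odd a = trans (col-next _) (cong not (col-pos-even a))

  true-on-cycle : Σ (Fin (suc k)) λ s → col (c s) ≡ true
  true-on-cycle with col (c zero) in eq
  ... | true  = zero , eq
  ... | false = next zero , trans (col-next zero) (cong not eq)

  q : ℕ
  q = suc (m + m)

  -- The largest j ≤ q with anc j v coloured true.
  jump : Fin n → ℕ
  jump v = if col v then m + m else q

  jump≤q : ∀ v → jump v ≤ q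
  jump≤q v with col v
  ... | true  = n≤1+n _
  ... | false = ≤-refl

  m+m≤jump : ∀ v → m + m ≤ jump v
  m+m≤jump v with col v
  ... | true  = ≤-refl
  ... | false = n≤1+n _

  col-anc-jump : ∀ v → col (anc (jump v) v) ≡ true
  col-anc-jump v with col v in eq
  ... | true  = trans (col-anc-even m v) eq
  ... | false = trans (col-anc-odd m v) (cong not eq)

  -- The depth q = 2m + 1 is odd, so it is only allowed above a root coloured true.
  depth≤jump⇒depth≤m+m : ∀ v → depth v ≤ jump v → col (root v) ≡ false → depth v ≤ m + m
  depth≤jump⇒depth≤m+m v d≤j root-false with m≤n⇒m<n∨m≡n (≤-trans d≤j (jump≤q v))
  ... | inj₁ d<q = ≤-pred d<q
  ... | inj₂ d≡q with col v in eq
  ...   | true  = d≤j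
  ...   | false with () ← trans (sym root-false)
                          (trans (cong (λ j → col (anc j v)) d≡q) (trans (col-anc-odd m v) (cong not eq)))

  Closed : (Fin n → Bool) → Set
  Closed S = ∀ v → S v ≡ true → S (p v) ≡ true

  closed-anc : ∀ {S} → Closed S → ∀ j {v} → S v ≡ true → S (anc j v) ≡ true
  closed-anc closed zero    Sv = Sv
  closed-anc closed (suc j) Sv = closed _ (closed-anc closed j Sv)

  ContainsCycle : (Fin n → Bool) → Set
  ContainsCycle S = ∀ i → S (c i) ≡ true

  3≤count : ∀ {S} → ContainsCycle S → 3 ≤ count S
  3≤count has-cycle = ≤-trans (m≤n⇒m≤1+n 3≤k) (injective⇒≤count c c-injective has-cycle)

  CoveredBy : List (Fin n) → Fin n → Set
  CoveredBy Q v = Σ ℕ λ i → i ≤ q × anc i v ∈ Q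

  record Cover (S : Fin n → Bool) : Set where
    field
      centres      : List (Fin n)
      centres-true : All (λ u → col u ≡ true) centres
      covers       : ∀ v → S v ≡ true → CoveredBy centres v
      few          : (2 + m) * length centres ≤ count S ⊎ length centres ≤ 1

  2+m≤1+jump : ∀ v → 2 + m ≤ suc (jump v)
  2+m≤1+jump v = s≤s (≤-trans (≤-trans (≤-reflexive (+-comm 1 m)) (+-monoʳ-≤ m 1≤m)) (m+m≤jump v))

  -- Removing the subtree of u = anc (jump v) v, for a deepest vertex v, deletes at least
  -- jump v + 1 ≥ m + 2 vertices, and u covers all of them.
  module Prune {S} (closed : Closed S) (has-cycle : ContainsCycle S)
               {v} (Sv : S v ≡ true) (jump<depth : jump v < depth v)
               (deepest : ∀ w → S w ≡ true → depth w ≤ depth v) where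

    u : Fin n
    u = anc (jump v) v

    depth-u : depth u + jump v ≡ depth v
    depth-u = depth-anc v (jump v) (<⇒≤ jump<depth)

    1≤depth-u : 1 ≤ depth u
    1≤depth-u with depth u in eq
    ... | zero  = ⊥-elim (<⇒≢ jump<depth (trans (sym (cong (_+ jump v) eq)) depth-u))
    ... | suc _ = s≤s z≤n

    Descends : Fin n → Set
    Descends w = depth u ≤ depth w × anc (depth w ∸ depth u) w ≡ u

    descends? : Decidable Descends
    descends? w = depth u ≤? depth w ×-dec anc (depth w ∸ depth u) w ≟ u

    pruned : Fin n → Bool
    pruned w = S w ∧ not (does (descends? w))

    pruned⁺ : ∀ {w} → S w ≡ true → ¬ Descends w → pruned w ≡ true
    pruned⁺ {w} Sw ¬D = cong₂ _∧_ Sw (cong not (dec-false (descends? w) ¬D))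

    pruned⁻ : ∀ {w} → pruned w ≡ true → S w ≡ true × ¬ Descends w
    pruned⁻ {w} e = ∧-conicalˡ _ _ e , λ D →
      not-¬ e (trans (cong (λ b → S w ∧ not b) (dec-true (descends? w) D)) (∧-zeroʳ (S w)))

    descends-p : ∀ {w} → Descends (p w) → Descends w
    descends-p {w} (u≤pw , anc≡u) = u≤w , (begin
      anc (depth w ∸ depth u) w              ≡⟨ cong (λ d → anc (d ∸ depth u) w) depth-w ⟩
      anc (suc (depth (p w)) ∸ depth u) w    ≡⟨ cong (λ d → anc d w) (+-∸-assoc 1 u≤pw) ⟩
      anc (suc (depth (p w) ∸ depth u)) w    ≡⟨ anc-p (depth (p w) ∸ depth u) w ⟨
      anc (depth (p w) ∸ depth u) (p w)      ≡⟨ anc≡u ⟩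
      u                                      ∎)
      where
      open ≡-Reasoning
      w-off-cycle : ¬ OnCycle w
      w-off-cycle on = <⇒≱ 1≤depth-u (≤-trans u≤pw (≤-reflexive (depth≡0 (OnCycle-p on))))
      depth-w : depth w ≡ suc (depth (p w))
      depth-w = depth-p w-off-cycle
      u≤w : depth u ≤ depth w
      u≤w = ≤-trans u≤pw (≤-trans (n≤1+n _) (≤-reflexive (sym depth-w)))

    pruned-closed : Closed pruned
    pruned-closed w e with pruned⁻ e
    ... | Sw , ¬D = pruned⁺ (closed w Sw) (¬D ∘ descends-p)

    pruned-cycle : ContainsCycle pruned
    pruned-cycle i = pruned⁺ (has-cycle i) λ (u≤ci , _) →
      <⇒≱ 1≤depth-u (≤-trans u≤ci (≤-reflexive (depth≡0 (i , refl))))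

    path-descends : ∀ j → j ≤ jump v → Descends (anc j v)
    path-descends j j≤jump = u≤ , (begin
      anc (depth (anc j v) ∸ depth u) (anc j v)  ≡⟨ anc-+ (depth (anc j v) ∸ depth u) j v ⟩
      anc ((depth (anc j v) ∸ depth u) + j) v    ≡⟨ cong (λ d → anc d v) gap ⟩
      u                                          ∎)
      where
      open ≡-Reasoning
      depth-path : depth (anc j v) + j ≡ depth u + jump v
      depth-path = trans (depth-anc v j (≤-trans j≤jump (<⇒≤ jump<depth))) (sym depth-u)
      u≤ : depth u ≤ depth (anc j v)
      u≤ = +-cancelʳ-≤ j _ _ (≤-trans (+-monoʳ-≤ (depth u) j≤jump) (≤-reflexive (sym depth-path)))
      gap : (depth (anc j v) ∸ depth u) + j ≡ jump v
      gap = +-cancelˡ-≡ (depth u) _ _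
        (trans (sym (+-assoc (depth u) _ j)) (trans (cong (_+ j) (m+[n∸m]≡n u≤)) depth-path))

    count-pruned : suc (jump v) + count pruned ≤ count S
    count-pruned = begin
      suc (jump v) + count pruned                            ≤⟨ +-monoˡ-≤ _ subtree ⟩
      count (λ w → S w ∧ does (descends? w)) + count pruned  ≡⟨ count-split S (does ∘ descends?) ⟨
      count S                                                ∎
      where
      open ≤-Reasoning
      path : Fin (suc (jump v)) → Fin n
      path i = anc (toℕ i) v
      path-injective : Injective _≡_ _≡_ path
      path-injective {i} {j} eq = toℕ-injective (anc-injective v
        (≤-trans (≤-pred (toℕ<n i)) (<⇒≤ jump<depth)) (≤-trans (≤-pred (toℕ<n j)) (<⇒≤ jump<depth)) eq)
      subtree : suc (jump v) ≤ count (λ w → S w ∧ does (descends? w))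
      subtree = injective⇒≤count path path-injective λ i →
        cong₂ _∧_ (closed-anc closed (toℕ i) Sv)
                  (dec-true (descends? _) (path-descends (toℕ i) (≤-pred (toℕ<n i))))

    extend : Cover pruned → Cover S
    extend cov = record
      { centres      = u ∷ centres
      ; centres-true = col-anc-jump v ∷ centres-true
      ; covers       = covers′
      ; few          = inj₁ (≤-trans (≤-reflexive (*-suc (2 + m) (length centres)))
                                     (≤-trans (few′ few) count-pruned))
      }
      where
      open Cover cov
      covers′ : ∀ w → S w ≡ true → CoveredBy (u ∷ centres) w
      covers′ w Sw with descends? w
      ... | yes (_ , anc≡u) = depth w ∸ depth u , w-close , here anc≡u
        where
        w-close : depth w ∸ depth u ≤ q
        w-close = begin
          depth w ∸ depth u             ≤⟨ ∸-monoˡ-≤ (depth u) (deepest w Sw) ⟩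
          depth v ∸ depth u             ≡⟨ cong (_∸ depth u) depth-u ⟨
          depth u + jump v ∸ depth u    ≡⟨ m+n∸m≡n (depth u) (jump v) ⟩
          jump v                        ≤⟨ jump≤q v ⟩
          q                             ∎
          where open ≤-Reasoning
      ... | no ¬D with covers w (pruned⁺ Sw ¬D)
      ...   | i , i≤q , ∈centres = i , i≤q , there ∈centres
      few′ : (2 + m) * length centres ≤ count pruned ⊎ length centres ≤ 1 →
             (2 + m) + (2 + m) * length centres ≤ suc (jump v) + count pruned
      few′ (inj₁ many) = +-mono-≤ (2+m≤1+jump v) many
      few′ (inj₂ ≤1)   = begin
        (2 + m) + (2 + m) * length centres  ≤⟨ +-monoʳ-≤ (2 + m) (*-monoʳ-≤ (2 + m) ≤1) ⟩
        (2 + m) + (2 + m) * 1               ≡⟨ twice-2+m m ⟩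
        suc (m + m) + 3                     ≤⟨ +-mono-≤ (s≤s (m+m≤jump v)) (3≤count pruned-cycle) ⟩
        suc (jump v) + count pruned         ∎
        where
        open ≤-Reasoning
        twice-2+m : ∀ m → (2 + m) + (2 + m) * 1 ≡ suc (m + m) + 3
        twice-2+m = solve-∀

  Violates : (Fin n → Bool) → Fin n → Set
  Violates S v = S v ≡ true × jump v < depth v

  violates? : ∀ S → Decidable (Violates S)
  violates? S v = (S v ≟ᵇ true) ×-dec (jump v <? depth v)

  deepest-violation : ∀ S {w} → Violates S w →
                      Σ (Fin n) λ v → Violates S v × (∀ x → S x ≡ true → depth x ≤ depth v)
  deepest-violation S {w} Vw = v , Vv , deepest
    where
    maximal : Σ (Fin n) λ v → does (violates? S v) ≡ true ×
                (∀ x → does (violates? S x) ≡ true → depth x ≤ depth v)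
    maximal = maximum-attained (does ∘ violates? S) depth (dec-true (violates? S w) Vw)
    v : Fin n
    v = proj₁ maximal
    Vv : Violates S v
    Vv = from-does (violates? S v) (proj₁ (proj₂ maximal))
    -- Anything deeper than v is deeper than 2m + 1 ≥ jump, so it violates too.
    deepest : ∀ x → S x ≡ true → depth x ≤ depth v
    deepest x Sx with jump x <? depth x
    ... | yes j<d = proj₂ (proj₂ maximal) x (dec-true (violates? S x) (Sx , j<d))
    ... | no  j≮d = ≤-trans (≮⇒≥ j≮d)
                      (≤-trans (jump≤q x) (≤-trans (s≤s (m+m≤jump v)) (proj₂ Vv)))

  deepest-violation-or-shallow :
    ∀ S → (Σ (Fin n) λ v → Violates S v × (∀ x → S x ≡ true → depth x ≤ depth v))
          ⊎ (∀ v → S v ≡ true → depth v ≤ jump v)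
  deepest-violation-or-shallow S with any? (violates? S)
  ... | yes (w , Vw) = inj₁ (deepest-violation S Vw)
  ... | no  none     = inj₂ λ v Sv → ≮⇒≥ λ j<d → none (v , Sv , j<d)

  Flat : (Fin n → Bool) → Set
  Flat S = ∀ v → S v ≡ true → depth v ≡ 0

  module Base {S} (closed : Closed S) (has-cycle : ContainsCycle S)
              (shallow : ∀ v → S v ≡ true → depth v ≤ jump v) where

    module Scan (s : Fin (suc k)) (s-true : col (c s) ≡ true)
                (B W : ℕ) (W+B≡ : W + B ≡ suc q) (bonus : B ≡ 1 ⊎ (B ≡ 0 × Flat S)) where

      open Walk s

      abstract
        index : Fin n → ℕ
        index y with onCycle? y
        ... | yes (i , _) = proj₁ (pos-surjective i)
        ... | no  _       = 0

        index<N : ∀ y → index y < suc k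
        index<N y with onCycle? y
        ... | yes (i , _) = proj₁ (proj₂ (pos-surjective i))
        ... | no  _       = s≤s z≤n

        c-pos-index : ∀ {y} → OnCycle y → c (pos (index y)) ≡ y
        c-pos-index {y} on with onCycle? y
        ... | yes (i , y≡ci) = trans (cong c (proj₂ (proj₂ (pos-surjective i)))) (sym y≡ci)
        ... | no  ¬on        = ⊥-elim (¬on on)

      index-c-pos : ∀ {t} → t < suc k → index (c (pos t)) ≡ t
      index-c-pos {t} t<N = pos-injective (index<N (c (pos t))) t<N (c-injective (c-pos-index (pos t , refl)))

      rootIndex : Fin n → ℕ
      rootIndex v = index (root v)

      rootIndex-c-pos : ∀ {t} → t < suc k → rootIndex (c (pos t)) ≡ t
      rootIndex-c-pos t<N = trans (cong index (root-C (_ , refl))) (index-c-pos t<N)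

      tree : ℕ → Fin n → Bool
      tree t x = S x ∧ does (rootIndex x ℕ.≟ t)

      seen : ℕ → Fin n → Bool
      seen t x = S x ∧ does (rootIndex x ≤? t)

      count-seen-suc : ∀ t → count (seen (suc t)) ≡ count (seen t) + count (tree (suc t))
      count-seen-suc t = trans (count-split (seen (suc t)) (λ x → does (rootIndex x ≤? t)))
        (cong₂ _+_ (count-cong λ x → trans (∧-assoc (S x) _ _) (cong (S x ∧_) (proj₁ (split (rootIndex x)))))
                   (count-cong λ x → trans (∧-assoc (S x) _ _) (cong (S x ∧_) (proj₂ (split (rootIndex x))))))
        where
        split : ∀ r → does (r ≤? suc t) ∧ does (r ≤? t) ≡ does (r ≤? t)
                    × does (r ≤? suc t) ∧ not (does (r ≤? t)) ≡ does (r ℕ.≟ suc t)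
        split r with r ≤? t
        ... | yes r≤t
          rewrite dec-true (r ≤? t) r≤t | dec-true (r ≤? suc t) (m≤n⇒m≤1+n r≤t)
                | dec-false (r ℕ.≟ suc t) (λ r≡ → <⇒≱ (n<1+n t) (subst (_≤ t) r≡ r≤t)) = refl , refl
        ... | no r≰t rewrite dec-false (r ≤? t) r≰t with r ℕ.≟ suc t
        ...   | yes r≡ rewrite dec-true (r ≤? suc t) (≤-reflexive r≡) | dec-true (r ℕ.≟ suc t) r≡ = refl , refl
        ...   | no r≢  rewrite dec-false (r ≤? suc t) (λ r≤ → r≢ (≤-antisym r≤ (≰⇒> r≰t)))
                             | dec-false (r ℕ.≟ suc t) r≢ = refl , refl

      1≤count-tree : ∀ {t} → t < suc k → 1 ≤ count (tree t)
      1≤count-tree {t} t<N = count-pos (c (pos t))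
        (cong₂ _∧_ (has-cycle (pos t)) (dec-true (rootIndex _ ℕ.≟ t) (rootIndex-c-pos t<N)))

      path≤count-tree : ∀ {w t} → S w ≡ true → rootIndex w ≡ t → suc (depth w) ≤ count (tree t)
      path≤count-tree {w} {t} Sw rw≡t = injective⇒≤count path path-injective λ i →
        cong₂ _∧_ (closed-anc closed (toℕ i) Sw)
                  (dec-true (rootIndex _ ℕ.≟ t)
                            (trans (cong index (root-anc w (toℕ i) (toℕ≤ i))) rw≡t))
        where
        toℕ≤ : ∀ (i : Fin (suc (depth w))) → toℕ i ≤ depth w
        toℕ≤ i = ≤-pred (toℕ<n i)
        path : Fin (suc (depth w)) → Fin n
        path i = anc (toℕ i) w
        path-injective : Injective _≡_ _≡_ path
        path-injective {i} {j} eq = toℕ-injective (anc-injective w (toℕ≤ i) (toℕ≤ j) eq)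

      tree⊆seen : ∀ t → count (tree t) ≤ count (seen t)
      tree⊆seen t = count-mono λ x e → cong₂ _∧_ (∧-conicalˡ _ _ e) (dec-true (rootIndex x ≤? t)
        (≤-reflexive (from-does (rootIndex x ℕ.≟ t) (∧-conicalʳ _ _ e))))

      centre : ℕ → Fin n
      centre a = c (pos (a + a))

      CoveredFrom : List ℕ → Fin n → Set
      CoveredFrom hs v = Σ ℕ λ a → a ∈ hs × a + a ≤ rootIndex v × depth v + (rootIndex v ∸ (a + a)) ≤ q

      covered-at-centre : ∀ {v a hs} → S v ≡ true → rootIndex v ≡ a + a → CoveredFrom (a ∷ hs) v
      covered-at-centre {v} {a} Sv r≡ = a , here refl , ≤-reflexive (sym r≡) , (begin
        depth v + (rootIndex v ∸ (a + a))  ≡⟨ cong (λ r → depth v + (r ∸ (a + a))) r≡ ⟩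
        depth v + (a + a ∸ (a + a))        ≡⟨ cong (depth v +_) (n∸n≡0 (a + a)) ⟩
        depth v + 0                        ≡⟨ +-identityʳ _ ⟩
        depth v                            ≤⟨ shallow v Sv ⟩
        jump v                             ≤⟨ jump≤q v ⟩
        q                                  ∎)
        where open ≤-Reasoning

      col-root-odd : ∀ {v a} → rootIndex v ≡ suc (a + a) → col (root v) ≡ false
      col-root-odd {v} {a} r≡ = begin
        col (root v)                   ≡⟨ cong col (c-pos-index (root∈C v)) ⟨
        col (c (pos (rootIndex v)))    ≡⟨ cong (λ t → col (c (pos t))) r≡ ⟩
        col (c (pos (suc (a + a))))    ≡⟨ col-pos-odd s a ⟩
        not (col (c s))                ≡⟨ cong not s-true ⟩
        false                          ∎
        where open ≡-Reasoning

      covered-after-centre : ∀ {v a hs} → S v ≡ true → rootIndex v ≡ suc (a + a) → CoveredFrom (a ∷ hs) v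
      covered-after-centre {v} {a} Sv r≡ = a , here refl , ≤-trans (n≤1+n _) (≤-reflexive (sym r≡)) , (begin
        depth v + (rootIndex v ∸ (a + a))  ≡⟨ cong (λ r → depth v + (r ∸ (a + a))) r≡ ⟩
        depth v + (suc (a + a) ∸ (a + a))  ≡⟨ cong (depth v +_) (m+n∸n≡m 1 (a + a)) ⟩
        depth v + 1                        ≡⟨ +-comm (depth v) 1 ⟩
        suc (depth v)                      ≤⟨ s≤s (depth≤jump⇒depth≤m+m v (shallow v Sv) root-false) ⟩
        q                                  ∎)
        where
        open ≤-Reasoning
        root-false : col (root v) ≡ false
        root-false = col-root-odd {v} {a} r≡

      covered-upto-suc : ∀ {t hs} → (∀ v → S v ≡ true → rootIndex v ≤ t → CoveredFrom hs v) →
                         (∀ v → S v ≡ true → rootIndex v ≡ suc t → CoveredFrom hs v) →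
                         ∀ v → S v ≡ true → rootIndex v ≤ suc t → CoveredFrom hs v
      covered-upto-suc old new v Sv r≤ with m≤n⇒m<n∨m≡n r≤
      ... | inj₁ r< = old v Sv (≤-pred r<)
      ... | inj₂ r≡ = new v Sv r≡

      covered-later : ∀ {v a hs} → CoveredFrom hs v → CoveredFrom (a ∷ hs) v
      covered-later (b , b∈ , rest) = b , there b∈ , rest

      -- The centres sit at the even positions 2 a, a ∈ half ∷ earlier, the last one at
      -- 2 half.  In mass, the vertices seen so far together with that last position pay
      -- for the t + 1 positions, the initial bonus B and W per centre after the first.
      record State (t : ℕ) : Set where
        field
          half       : ℕ
          earlier    : List ℕ
          centre≤t   : half + half ≤ t
          t≤centre+q : t ≤ half + half + q
          covered    : ∀ v → S v ≡ true → rootIndex v ≤ t → CoveredFrom (half ∷ earlier) v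
          mass       : suc t + B + length earlier * W ≤ count (seen t) + (half + half)

      Uncovered : ℕ → ℕ → Fin n → Set
      Uncovered t C w = S w ≡ true × rootIndex w ≡ suc t × q < depth w + (suc t ∸ C)

      uncovered? : ∀ t C → Decidable (Uncovered t C)
      uncovered? t C w = (S w ≟ᵇ true) ×-dec (rootIndex w ℕ.≟ suc t) ×-dec (q <? depth w + (suc t ∸ C))

      W≤1+q : W ≤ suc q
      W≤1+q = ≤-trans (m≤m+n W B) (≤-reflexive W+B≡)

      module _ {t} (st : State t) where
        open State st

        keep-centre : suc t < suc k → (∀ w → ¬ Uncovered t (half + half) w) → State (suc t)
        keep-centre t<k none = record
          { half = half ; earlier = earlier
          ; centre≤t   = m≤n⇒m≤1+n centre≤t
          ; t≤centre+q = ≤-trans (m≤n+m∸n (suc t) (half + half)) (+-monoʳ-≤ (half + half) next-near)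
          ; covered    = covered-upto-suc covered λ v Sv r≡ →
              half , here refl , ≤-trans (m≤n⇒m≤1+n centre≤t) (≤-reflexive (sym r≡)) ,
              subst (λ r → depth v + (r ∸ (half + half)) ≤ q) (sym r≡) (near v Sv r≡)
          ; mass       = subst (λ x → suc (suc t) + B + length earlier * W ≤ x + (half + half))
                               (sym (count-seen-suc t))
                               (mass-grows {t} {B} {length earlier * W} {count (seen t)} {C = half + half}
                                           mass (1≤count-tree t<k))
          }
          where
          near : ∀ v → S v ≡ true → rootIndex v ≡ suc t → depth v + (suc t ∸ (half + half)) ≤ q
          near v Sv r≡ = ≮⇒≥ λ far → none v (Sv , r≡ , far)
          next-near : suc t ∸ (half + half) ≤ q
          next-near = subst (λ d → d + (suc t ∸ (half + half)) ≤ q) (depth≡0 (pos (suc t) , refl))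
                        (near (c (pos (suc t))) (has-cycle _) (rootIndex-c-pos t<k))

        new-centre : ∀ {a w} → Uncovered t (half + half) w → a + a ≤ suc t → suc t ≤ a + a + q →
                     (half + half) + W ≤ depth w + (a + a) →
                     (∀ v → S v ≡ true → rootIndex v ≡ suc t → CoveredFrom (a ∷ half ∷ earlier) v) →
                     State (suc t)
        new-centre {a} {w} (Sw , rw≡ , _) a≤ ≤a gain new = record
          { half = a ; earlier = half ∷ earlier
          ; centre≤t   = a≤
          ; t≤centre+q = ≤a
          ; covered    = covered-upto-suc (λ v Sv r≤ → covered-later (covered v Sv r≤)) new
          ; mass       = subst (λ x → suc (suc t) + B + length (half ∷ earlier) * W ≤ x + (a + a))
                               (sym (count-seen-suc t))
                               (mass-new-centre {t} {B} {length earlier * W} {F = count (seen t)} {C = half + half}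
                                                mass (path≤count-tree Sw rw≡) gain)
          }

        -- The centre moves onto position t + 1 itself.
        new-centre-even : ∀ {a w} → Uncovered t (half + half) w → suc t ≡ a + a → State (suc t)
        new-centre-even {a} {w} unc@(_ , _ , far) even =
          new-centre {a} unc (≤-reflexive (sym even)) (≤-trans (≤-reflexive even) (m≤m+n _ q))
            (subst (λ x → half + half + W ≤ depth w + x) even
              (gain-from-violation (m≤n⇒m≤1+n centre≤t) (≤-trans W≤1+q far)))
            (λ v Sv r≡ → covered-at-centre {v} {a} Sv (trans r≡ even))

        -- Without bonus all trees are trivial, so the uncovered position 2 half + q + 1 is even.
        odd⇒bonus : ∀ {a w} → Uncovered t (half + half) w → suc t ≡ suc (a + a) → B ≡ 1
        odd⇒bonus {a} {w} (Sw , _ , far) odd = [ id , (λ (_ , flat) → ⊥-elim (flat-impossible flat)) ]′ bonus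
          where
          flat-impossible : Flat S → ⊥
          flat-impossible flat = even≢odd′ (half + suc m) a (begin
            (half + suc m) + (half + suc m)  ≡⟨ rearrange half m ⟩
            half + half + suc q              ≡⟨ ≤-antisym below above ⟩
            suc t                            ≡⟨ odd ⟩
            suc (a + a)                      ∎)
            where
            open ≡-Reasoning
            rearrange : ∀ h m → (h + suc m) + (h + suc m) ≡ h + h + suc (suc (m + m))
            rearrange = solve-∀
            far′ : suc q ≤ suc t ∸ (half + half)
            far′ = subst (λ d → q < d + (suc t ∸ (half + half))) (flat w Sw) far
            below : half + half + suc q ≤ suc t
            below = ≤-trans (+-monoʳ-≤ (half + half) far′) (≤-reflexive (m+[n∸m]≡n (m≤n⇒m≤1+n centre≤t)))
            above : suc t ≤ half + half + suc q
            above = ≤-trans (s≤s t≤centre+q) (≤-reflexive (sym (+-suc (half + half) q)))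

        -- The centre moves onto position t, which is coloured true.
        new-centre-odd : ∀ {a w} → Uncovered t (half + half) w → suc t ≡ suc (a + a) → State (suc t)
        new-centre-odd {a} {w} unc@(_ , _ , far) odd = new-centre {a} unc
          (≤-trans (≤-reflexive (sym t≡)) (n≤1+n t))
          (≤-trans (≤-reflexive (trans odd (+-comm 1 (a + a)))) (+-monoʳ-≤ (a + a) (s≤s z≤n)))
          (≤-pred (subst₂ _≤_ (+-suc (half + half) W)
                              (trans (cong (λ x → depth w + suc x) t≡) (+-suc (depth w) (a + a)))
            (gain-from-violation (m≤n⇒m≤1+n centre≤t) (≤-trans (≤-reflexive 1+W≡1+q) far))))
          (λ v Sv r≡ → covered-after-centre {v} {a} Sv (trans r≡ odd))
          where
          t≡ : t ≡ a + a
          t≡ = suc-injective odd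
          1+W≡1+q : suc W ≡ suc q
          1+W≡1+q = trans (trans (+-comm 1 W) (cong (W +_) (sym (odd⇒bonus {a} unc odd)))) W+B≡

      scan-step : ∀ {t} → suc t < suc k → State t → State (suc t)
      scan-step {t} t<k st with any? (uncovered? t (State.half st + State.half st))
      ... | no  none = keep-centre st t<k λ w unc → none (w , unc)
      ... | yes (w , unc) with parity (suc t)
      ...   | inj₁ (a , even) = new-centre-even st {a} unc even
      ...   | inj₂ (a , odd)  = new-centre-odd st {a} unc odd

      start-at-0 : suc B ≤ count (tree 0) → State 0
      start-at-0 big = record
        { half = 0 ; earlier = []
        ; centre≤t   = z≤n
        ; t≤centre+q = z≤n
        ; covered    = λ v Sv r≤0 → covered-at-centre {v} {0} Sv (n≤0⇒n≡0 r≤0)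
        ; mass       = begin
            suc B + 0              ≡⟨ +-identityʳ _ ⟩
            suc B                  ≤⟨ big ⟩
            count (tree 0)         ≤⟨ tree⊆seen 0 ⟩
            count (seen 0)         ≡⟨ +-identityʳ _ ⟨
            count (seen 0) + 0     ∎
        }
        where open ≤-Reasoning

      start-at-1 : B ≤ 1 → 2 ≤ count (tree 1) → State 1
      start-at-1 B≤1 big = record
        { half = 0 ; earlier = []
        ; centre≤t   = z≤n
        ; t≤centre+q = s≤s z≤n
        ; covered    = covered-upto-suc (λ v Sv r≤0 → covered-at-centre {v} {0} Sv (n≤0⇒n≡0 r≤0))
                                        (λ v Sv r≡1 → covered-after-centre {v} {0} Sv r≡1)
        ; mass       = begin
            2 + B + 0                        ≡⟨ +-identityʳ _ ⟩
            2 + B                            ≤⟨ +-monoʳ-≤ 2 B≤1 ⟩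
            1 + 2                            ≤⟨ +-mono-≤ (≤-trans (1≤count-tree (s≤s z≤n)) (tree⊆seen 0)) big ⟩
            count (seen 0) + count (tree 1)  ≡⟨ count-seen-suc 0 ⟨
            count (seen 1)                   ≡⟨ +-identityʳ _ ⟨
            count (seen 1) + 0               ∎
        }
        where open ≤-Reasoning

      advance : ∀ d {t} → t + d ≡ k → State t → State k
      advance zero    {t} t+0≡k st = subst State (trans (sym (+-identityʳ t)) t+0≡k) st
      advance (suc d) {t} t+d≡k st =
        advance d (trans (sym (+-suc t d)) t+d≡k)
          (scan-step (s≤s (≤-trans (s≤s (m≤m+n t d)) (≤-reflexive (trans (sym (+-suc t d)) t+d≡k)))) st)

      finish : State k → Cover S
      finish st = record
        { centres      = map centre (half ∷ earlier)
        ; centres-true = map⁺ (All.universal (λ a → trans (col-pos-even s a) s-true) (half ∷ earlier))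
        ; covers       = covers
        ; few          = few earlier mass
        }
        where
        open State st
        covers : ∀ v → S v ≡ true → CoveredBy (map centre (half ∷ earlier)) v
        covers v Sv with covered v Sv (≤-pred (index<N (root v)))
        ... | a , a∈ , 2a≤r , close =
          (rootIndex v ∸ (a + a)) + depth v , subst (_≤ q) (+-comm (depth v) _) close ,
          subst (_∈ map centre (half ∷ earlier)) (sym reach-centre) (∈-map⁺ centre a∈)
          where
          d : ℕ
          d = rootIndex v ∸ (a + a)
          reach-centre : anc (d + depth v) v ≡ centre a
          reach-centre = begin
            anc (d + depth v) v                ≡⟨ anc-+ d (depth v) v ⟨
            anc d (root v)                     ≡⟨ cong (anc d) (c-pos-index (root∈C v)) ⟨
            anc d (c (pos (rootIndex v)))      ≡⟨ cong (λ r → anc d (c (pos r))) (m∸n+n≡m 2a≤r) ⟨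
            anc d (c (pos (d + (a + a))))      ≡⟨ anc-pos d (a + a) ⟩
            c (pos (a + a))                    ∎
            where open ≡-Reasoning
        last<k : suc (half + half) ≤ k
        last<k = ≤∧≢⇒< centre≤t λ 2half≡k → even≢odd′ ℓ half (sym (trans (cong suc 2half≡k) cycle-length))
        few : ∀ es → suc k + B + length es * W ≤ count (seen k) + (half + half) →
              (2 + m) * length (map centre (half ∷ es)) ≤ count S ⊎ length (map centre (half ∷ es)) ≤ 1
        few []       _    = inj₂ ≤-refl
        few (e ∷ es) mass = inj₁ (begin
          (2 + m) * length (map centre (half ∷ e ∷ es))  ≡⟨ cong ((2 + m) *_) (length-map centre (half ∷ e ∷ es)) ⟩
          (2 + m) * (2 + length es)                      ≤⟨ centres-bound (length es) 1≤m W+B≡ B∈01 ⟩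
          2 + (B + (1 + length es) * W)                  ≤⟨ mass-without-centre last<k mass′ ⟩
          count (seen k)                                 ≤⟨ count-mono (λ x → ∧-conicalˡ (S x) _) ⟩
          count S                                        ∎)
          where
          open ≤-Reasoning
          B∈01 : B ≡ 1 ⊎ B ≡ 0
          B∈01 = [ inj₁ , inj₂ ∘ proj₁ ]′ bonus
          mass′ : suc k + (B + (1 + length es) * W) ≤ count (seen k) + (half + half)
          mass′ = subst (_≤ count (seen k) + (half + half)) (+-assoc (suc k) B _) mass

      cover-from-0 : suc B ≤ count (tree 0) → Cover S
      cover-from-0 = finish ∘ advance k refl ∘ start-at-0

      cover-from-1 : B ≤ 1 → 2 ≤ count (tree 1) → Cover S
      cover-from-1 B≤1 = finish ∘ advance (k ∸ 1) (m+[n∸m]≡n (≤-trans (s≤s z≤n) 3≤k)) ∘ start-at-1 B≤1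

    Tall : Fin (suc k) → Fin n → Set
    Tall i w = S w ≡ true × root w ≡ c i × 1 ≤ depth w

    tall? : ∀ i → Decidable (Tall i)
    tall? i w = (S w ≟ᵇ true) ×-dec (root w ≟ c i) ×-dec (1 ≤? depth w)

    -- Start at a true position whose tree, or the tree right after it, is not just its
    -- root (bonus B = 1); if all trees are trivial, start anywhere with B = 0.
    base-cover : Cover S
    base-cover with any? (λ i → any? (tall? i))
    ... | yes (i , w , Sw , root≡ , 1≤d) with col (c i) in col-i
    ...   | true  = cover-from-0 (≤-trans (s≤s 1≤d) (path≤count-tree Sw rootIndex≡0))
      where
      open Scan i col-i 1 q (+-comm q 1) (inj₁ refl)
      rootIndex≡0 : rootIndex w ≡ 0
      rootIndex≡0 = trans (cong index root≡) (index-c-pos (s≤s z≤n))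
    ...   | false = cover-from-1 ≤-refl (≤-trans (s≤s 1≤d) (path≤count-tree Sw rootIndex≡1))
      where
      col-prev : col (c (prev i)) ≡ true
      col-prev = trans (cong col (sym (p-c i))) (trans (col-p (c i)) (cong not col-i))
      open Scan (prev i) col-prev 1 q (+-comm q 1) (inj₁ refl)
      rootIndex≡1 : rootIndex w ≡ 1
      rootIndex≡1 = trans (cong index (trans root≡ (cong c (sym (next-prev i)))))
                          (index-c-pos (s≤s (≤-trans (s≤s z≤n) 3≤k)))
    base-cover | no no-tall with true-on-cycle
    ... | s , s-true = cover-from-0 (1≤count-tree (s≤s z≤n))
      where
      flat : Flat S
      flat v Sv with depth v in d≡
      ... | zero  = refl
      ... | suc _ = ⊥-elim (no-tall (proj₁ (root∈C v) , v , Sv , proj₂ (root∈C v) ,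
                                     subst (1 ≤_) (sym d≡) (s≤s z≤n)))
      open Scan s s-true 0 (suc q) (+-identityʳ _) (inj₂ (refl , flat))

  cover : ∀ fuel S → count S ≤ fuel → Closed S → ContainsCycle S → Cover S
  cover fuel S S≤fuel closed has-cycle with deepest-violation-or-shallow S
  ... | inj₂ shallow = Base.base-cover closed has-cycle shallow
  ... | inj₁ (v , (Sv , jump<depth) , deepest) with fuel
  ...   | zero   = ⊥-elim (<⇒≱ (≤-trans (s≤s z≤n) (3≤count has-cycle)) S≤fuel)
  ...   | suc fuel′ =
    extend (cover fuel′ pruned (≤-pred (≤-trans smaller S≤fuel)) pruned-closed pruned-cycle)
    where
    open Prune closed has-cycle Sv jump<depth deepest
    smaller : suc (count pruned) ≤ count S
    smaller = ≤-trans (s≤s (m≤n+m _ (jump v))) count-pruned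

  centres-exist : 2 + m ≤ n → Σ (List (Fin n)) λ Q →
                  All (λ u → col u ≡ true) Q × (∀ v → CoveredBy Q v) × (2 + m) * length Q ≤ n
  centres-exist 2+m≤n = centres , centres-true , (λ v → covers v refl) , few′ few
    where
    open Cover (cover n (λ _ → true) (≤-reflexive (count-all n)) (λ _ _ → refl) (λ _ → refl))
    few′ : (2 + m) * length centres ≤ count {n} (λ _ → true) ⊎ length centres ≤ 1 →
           (2 + m) * length centres ≤ n
    few′ (inj₁ many) = ≤-trans many (≤-reflexive (count-all n))
    few′ (inj₂ ≤1)   = ≤-trans (*-monoʳ-≤ (2 + m) ≤1) (≤-trans (≤-reflexive (*-identityʳ (2 + m))) 2+m≤n)

-- From the digraph to its parent map

module FromDigraph {n} (A : Digraph n) (in-degree : InDegreeOne A) where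

  parent : Fin n → Fin n
  parent v = proj₁ (in-degree v)

  parent-arc : ∀ v → A (parent v) v
  parent-arc v = proj₁ (proj₂ (in-degree v))

  arc⇒parent : ∀ {u v} → A u v → u ≡ parent v
  arc⇒parent {u} {v} a = proj₂ (proj₂ (in-degree v)) u a

  open Ancestors parent public

  walk-from-anc : ∀ i v → DWalk A (anc i v) v i
  walk-from-anc zero    v = here
  walk-from-anc (suc i) v = step (parent-arc (anc i v)) (walk-from-anc i v)

  ancestor-in : ∀ {C : Fin n → Set} → (∀ {x} → C x → C (parent x)) →
                ∀ {x y} → UWalk A x y → Σ ℕ (λ j → C (anc j x)) → Σ ℕ (λ j → C (anc j y))
  ancestor-in C-p here = id
  ancestor-in {C} C-p (fwd {x} {y} a w) (j , Cj) =
    ancestor-in {C} C-p w (suc j , subst C (anc-p j y) (subst (λ z → C (anc j z)) (arc⇒parent a) Cj))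
  ancestor-in {C} C-p (bwd {x} {y} a w) (j , Cj) =
    ancestor-in {C} C-p w (j , subst C (sym (trans (cong (anc j) (arc⇒parent a)) (anc-p j x))) (C-p Cj))

  colour-alternates : ∀ {U : Subset n} → IsBipartition A U → ∀ v → lookup U (parent v) ≡ not (lookup U v)
  colour-alternates {U} bipartite v = ¬-not λ same → case bipartite (parent v) v (parent-arc v) of λ where
    (inj₁ (pv∈ , v∉)) → v∉ (lookup⇒[]= v U (trans (sym same) ([]=⇒lookup pv∈)))
    (inj₂ (pv∉ , v∈)) → pv∉ (lookup⇒[]= (parent v) U (trans same ([]=⇒lookup v∈)))

  module _ {U : Subset n} (bipartite : IsBipartition A U) where

    kernel-from-centres :
      ∀ m → Σ (List (Fin n)) (λ Q → All (λ u → lookup U u ≡ true) Q ×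
                                   (∀ v → Σ ℕ λ i → i ≤ suc (m + m) × anc i v ∈ Q) ×
                                   (2 + m) * length Q ≤ n) →
      Σ (Subset n) λ K → IsQKernel A (suc (m + m)) K × K ⊆ U × (suc (m + m) + 3) * ∣ K ∣ ≤ 2 * n
    kernel-from-centres m (Q , Q-true , covers , Q-small) = K , (independent , dominating) , K⊆U , K-small
      where
      K : Subset n
      K = tabulate (_∈ᵇ Q)
      ∈K⇒∈Q : ∀ {x} → x ∈ₛ K → x ∈ Q
      ∈K⇒∈Q {x} x∈K =
        from-does (Any.any? (x ≟_) Q) (trans (sym (lookup∘tabulate (_∈ᵇ Q) x)) ([]=⇒lookup x∈K))
      ∈Q⇒∈K : ∀ {x} → x ∈ Q → x ∈ₛ K
      ∈Q⇒∈K {x} x∈Q =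
        lookup⇒[]= x K (trans (lookup∘tabulate (_∈ᵇ Q) x) (dec-true (Any.any? (x ≟_) Q) x∈Q))
      true-on-K : ∀ {x} → x ∈ₛ K → lookup U x ≡ true
      true-on-K = All.lookup Q-true ∘ ∈K⇒∈Q
      independent : Independent A K
      independent u v u∈K v∈K a = not-¬ (true-on-K u∈K) (begin
        lookup U u               ≡⟨ cong (lookup U) (arc⇒parent a) ⟩
        lookup U (parent v)      ≡⟨ colour-alternates bipartite v ⟩
        not (lookup U v)         ≡⟨ cong not (true-on-K v∈K) ⟩
        not true                 ∎)
        where open ≡-Reasoning
      dominating : ∀ v → DistLe A K v (suc (m + m))
      dominating v with covers v
      ... | i , i≤q , anc∈Q = anc i v , ∈Q⇒∈K anc∈Q , i , i≤q , walk-from-anc i v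
      K⊆U : K ⊆ U
      K⊆U {x} x∈K = lookup⇒[]= x U (true-on-K x∈K)
      K-small : (suc (m + m) + 3) * ∣ K ∣ ≤ 2 * n
      K-small = begin
        (suc (m + m) + 3) * ∣ K ∣     ≡⟨ double m ∣ K ∣ ⟩
        2 * ((2 + m) * ∣ K ∣)        ≤⟨ *-monoʳ-≤ 2 (*-monoʳ-≤ (2 + m) K≤Q) ⟩
        2 * ((2 + m) * length Q)     ≤⟨ *-monoʳ-≤ 2 Q-small ⟩
        2 * n                        ∎
        where
        open ≤-Reasoning
        double : ∀ m x → (suc (m + m) + 3) * x ≡ 2 * ((2 + m) * x)
        double = solve-∀
        K≤Q : ∣ K ∣ ≤ length Q
        K≤Q = ≤-trans (≤-reflexive (∣tabulate∣≡count (_∈ᵇ Q))) (count-∈ᵇ Q)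

odd⇒1+double : ∀ {q} → q % 2 ≡ 1 → q ≡ suc (q / 2 + q / 2)
odd⇒1+double {q} q-odd = begin
  q                      ≡⟨ m≡m%n+[m/n]*n q 2 ⟩
  q % 2 + q / 2 * 2      ≡⟨ cong (_+ q / 2 * 2) q-odd ⟩
  suc (q / 2 * 2)        ≡⟨ cong suc (*-comm (q / 2) 2) ⟩
  suc (2 * (q / 2))      ≡⟨ cong (λ x → suc (q / 2 + x)) (+-identityʳ (q / 2)) ⟩
  suc (q / 2 + q / 2)    ∎
  where open ≡-Reasoning

3≤1+double⇒1≤ : ∀ {m} → 3 ≤ suc (m + m) → 1 ≤ m
3≤1+double⇒1≤ {zero}  (s≤s ())
3≤1+double⇒1≤ {suc m} _ = s≤s z≤n

1+double+3≤2n⇒2+≤ : ∀ {m n} → suc (m + m) + 3 ≤ 2 * n → 2 + m ≤ n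
1+double+3≤2n⇒2+≤ {m} le = *-cancelˡ-≤ 2 (≤-trans (≤-reflexive (double m)) le)
  where
  double : ∀ m → 2 * (2 + m) ≡ suc (m + m) + 3
  double = solve-∀

proposition6p4 : (n : ℕ) (A : Digraph n) → Unicyclic A →
    (ℓ : ℕ) → 2 ≤ ℓ → DirectedCycle A (2 * ℓ) →
    (U : Subset n) → IsBipartition A U →
    (q : ℕ) → 3 ≤ q → q % 2 ≡ 1 → q + 3 ≤ 2 * n →
    Σ (Subset n) λ Q → IsQKernel A q Q × Q ⊆ U × (q + 3) * ∣ Q ∣ ≤ 2 * n
proposition6p4 _ _ _ (suc zero) (s≤s ()) _ _ _ _ _ _ _
proposition6p4 n A (in-degree , connected) ℓ@(suc (suc _)) _ (c , c-injective , c-arc , c-closing)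
               U bipartite q 3≤q q-odd q+3≤2n =
  subst (λ q → Σ (Subset n) λ K → IsQKernel A q K × K ⊆ U × (q + 3) * ∣ K ∣ ≤ 2 * n) (sym q≡)
        (kernel-from-centres bipartite m (centres-exist 2+m≤n))
  where
  open FromDigraph A in-degree
  m : ℕ
  m = q / 2
  q≡ : q ≡ suc (m + m)
  q≡ = odd⇒1+double q-odd
  2+m≤n : 2 + m ≤ n
  2+m≤n = 1+double+3≤2n⇒2+≤ (subst (λ q → q + 3 ≤ 2 * n) q≡ q+3≤2n)
  p-c-suc : ∀ i → parent (c (suc i)) ≡ c (inject₁ i)
  p-c-suc i = sym (arc⇒parent (c-arc i))
  p-c-zero : parent (c zero) ≡ c (fromℕ _)
  p-c-zero = sym (arc⇒parent c-closing)
  open Cycle parent c p-c-suc p-c-zero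
  reaches : ∀ v → Σ ℕ λ j → OnCycle (anc j v)
  reaches v = ancestor-in {OnCycle} OnCycle-p (connected (c zero) v) (0 , zero , refl)
  open Construction parent (lookup U) (colour-alternates bipartite) c c-injective p-c-suc p-c-zero reaches
         ℓ (s≤s (s≤s z≤n)) (cong (ℓ +_) (+-identityʳ ℓ)) m (3≤1+double⇒1≤ (subst (3 ≤_) q≡ 3≤q))
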